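{- Let $G$ be the disjoint union of two isomorphic graphs $H_1$ and $H_2$ with vertex sets $V=\{v_1,\dots,v_k\}$ and $W=\{w_1,\dots,w_k\}$ respectively, such that the map $f(v_i)=w_i$ ($1\le i\le k$) is a graph isomorphism from $H_1$ to $H_2$. Then there exist $k$ complete bipartite graphs $B_1,\dots,B_k$ with parts $(X_1,Y_1),\dots,(X_k,Y_k)$ respectively such that (i) $B_1,\dots,B_k$ form an odd cover of $G$, and (ii) $X_i=\{v_i,w_i\}$ for all $1\le i\le k$.
   Context: An odd cover of a graph $G$ is a collection of complete bipartite graphs with parts $(X,Y)$, $X,Y\subseteq V(G)$ disjoint (a part may be empty), such that each edge of $G$ has one endpoint in $X$ and the other in $Y$ for an odd number of them and each nonedge of $G$ is so covered by an even number of them. -}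

module Defs where

open import Data.Nat using (ℕ; zero; suc; _+_; _%_)
open import Data.Bool using (Bool; true; false; _∧_; _∨_; if_then_else_)
open import Data.Fin using (Fin; zero; suc)
open import Data.Sum using (_⊎_; inj₁; inj₂)
open import Data.Product using (_×_)
open import Relation.Binary.PropositionalEquality using (_≡_; _≢_)
open import Relation.Nullary using (¬_)

record Graph (V : Set) : Set where
  field
    adj    : V → V → Bool
    sym    : ∀ u v → adj u v ≡ adj v u
    irrefl : ∀ v → adj v v ≡ false
open Graph public

Subset : Set → Set
Subset V = V → Bool

record Biclique (V : Set) : Set where
  constructor biclique
  field
    X Y      : Subset V
    disjoint : ∀ v → ¬ (X v ≡ true × Y v ≡ true)
open Biclique public

covers : {V : Set} → Biclique V → V → V → Bool
covers B u v = (X B u ∧ Y B v) ∨ (X B v ∧ Y B u)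

countTrue : ∀ {n} → (Fin n → Bool) → ℕ
countTrue {zero}  p = 0
countTrue {suc n} p = (if p zero then 1 else 0) + countTrue (λ t → p (suc t))

IsOddCover : {V : Set} {n : ℕ} → Graph V → (Fin n → Biclique V) → Set
IsOddCover G B = ∀ u v → u ≢ v →
  (adj G u v ≡ true  → countTrue (λ t → covers (B t) u v) % 2 ≡ 1) ×
  (adj G u v ≡ false → countTrue (λ t → covers (B t) u v) % 2 ≡ 0)

disjointUnion : {A B : Set} → Graph A → Graph B → Graph (A ⊎ B)
disjointUnion {A} {B} H₁ H₂ = record { adj = a ; sym = s ; irrefl = i }
  where
  a : A ⊎ B → A ⊎ B → Bool
  a (inj₁ x) (inj₁ y) = adj H₁ x y
  a (inj₂ x) (inj₂ y) = adj H₂ x y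
  a (inj₁ x) (inj₂ y) = false
  a (inj₂ x) (inj₁ y) = false
  s : ∀ u v → a u v ≡ a v u
  s (inj₁ x) (inj₁ y) = sym H₁ x y
  s (inj₂ x) (inj₂ y) = sym H₂ x y
  s (inj₁ x) (inj₂ y) = _≡_.refl
  s (inj₂ x) (inj₁ y) = _≡_.refl
  i : ∀ v → a v v ≡ false
  i (inj₁ x) = irrefl H₁ x
  i (inj₂ x) = irrefl H₂ x

{-# OPTIONS --safe #-}
module Submission where

open import Defs
open import Data.Nat using (ℕ; zero; suc; _+_; _%_)
open import Data.Nat.Properties using (+-comm; +-identityʳ)
open import Data.Bool using (Bool; true; false; _∧_; if_then_else_)
open import Data.Bool.Properties using (∨-comm; ∨-identityʳ)
open import Data.Fin using (Fin; zero; suc; _<?_; _≟_)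
open import Data.Fin.Properties using (<-cmp; suc-injective)
open import Data.Sum using (_⊎_; inj₁; inj₂; [_,_]′)
open import Data.Product using (Σ; _×_; _,_)
open import Function using (id; _∘_)
open import Function.Bundles using (_⇔_; mk⇔; Equivalence)
open import Function.Construct.Composition using (_⇔-∘_)
open import Relation.Binary using (tri<; tri≈; tri>)
open import Relation.Binary.PropositionalEquality using (_≡_; _≢_; refl; cong; cong₂; trans; ≢-sym)
import Relation.Binary.PropositionalEquality as ≡
open import Relation.Nullary using (Dec; does; yes; no; ¬_; contradiction)
open import Relation.Nullary.Decidable using (dec-true; dec-false)

-- Orient every edge of H₁ (= H₂) from its smaller to its larger endpoint and
-- let B_t have X_t = {v_t, w_t} and Y_t = the out-neighbours of t among the
-- v's together with the in-neighbours of t among the w's.  A pair {x, y} with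
-- distinct indices i ≠ j is covered only by B_i and B_j, and by exactly those
-- whose index is the tail of the oriented edge ij; that tail is the same for
-- both copies.  So v_i v_j and w_i w_j are covered once iff ij is an edge,
-- v_i w_j is covered by both or by neither, and v_i w_i is covered by nothing
-- since H₁ has no loops.

indicator : Bool → ℕ
indicator b = if b then 1 else 0

indicator-%2 : ∀ b → indicator b % 2 ≡ indicator b
indicator-%2 true  = refl
indicator-%2 false = refl

indicator-double-%2 : ∀ b → (indicator b + indicator b) % 2 ≡ 0
indicator-double-%2 true  = refl
indicator-double-%2 false = refl

indicator-split-< : ∀ {k} c {a b : Fin k} → a ≢ b →
  indicator (c ∧ does (a <? b)) + indicator (c ∧ does (b <? a)) ≡ indicator c
indicator-split-< false _ = refl
indicator-split-< true {a} {b} a≢b with <-cmp a b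
... | tri< a<b _ b≮a rewrite dec-true (a <? b) a<b | dec-false (b <? a) b≮a = refl
... | tri≈ _ a≡b _ = contradiction a≡b a≢b
... | tri> a≮b _ b<a rewrite dec-false (a <? b) a≮b | dec-true (b <? a) b<a = refl

does-true⇔ : ∀ {A : Set} (a? : Dec A) → does a? ≡ true ⇔ A
does-true⇔ a? = mk⇔ (witness a?) (dec-true a?)
  where
  witness : ∀ {A : Set} (a? : Dec A) → does a? ≡ true → A
  witness (yes a) _ = a

parity⇒IsOddCover-clause : ∀ c m → m % 2 ≡ indicator c →
  (c ≡ true → m % 2 ≡ 1) × (c ≡ false → m % 2 ≡ 0)
parity⇒IsOddCover-clause c m eq = (λ { refl → eq }) , (λ { refl → eq })

countTrue-none : ∀ {n} (p : Fin n → Bool) → (∀ t → p t ≡ false) → countTrue p ≡ 0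
countTrue-none {zero}  p none = refl
countTrue-none {suc n} p none rewrite none zero = countTrue-none (λ t → p (suc t)) (λ t → none (suc t))

countTrue-single : ∀ {n} (p : Fin n → Bool) a → (∀ t → t ≢ a → p t ≡ false) →
  countTrue p ≡ indicator (p a)
countTrue-single {suc n} p zero outside
  rewrite countTrue-none (λ t → p (suc t)) (λ t → outside (suc t) λ ()) = +-identityʳ _
countTrue-single {suc n} p (suc a) outside rewrite outside zero (λ ()) =
  countTrue-single (λ t → p (suc t)) a (λ t t≢a → outside (suc t) (λ e → t≢a (suc-injective e)))

countTrue-pair : ∀ {n} (p : Fin n → Bool) a b → a ≢ b → (∀ t → t ≢ a → t ≢ b → p t ≡ false) →
  countTrue p ≡ indicator (p a) + indicator (p b)
countTrue-pair p zero zero a≢b _ = contradiction refl a≢b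
countTrue-pair p zero (suc b) _ outside =
  cong (indicator (p zero) +_)
       (countTrue-single _ b (λ t t≢b → outside (suc t) (λ ()) (λ e → t≢b (suc-injective e))))
countTrue-pair p (suc a) zero _ outside =
  trans (cong (indicator (p zero) +_)
               (countTrue-single _ a (λ t t≢a → outside (suc t) (λ e → t≢a (suc-injective e)) (λ ()))))
        (+-comm (indicator (p zero)) _)
countTrue-pair p (suc a) (suc b) a≢b outside rewrite outside zero (λ ()) (λ ()) =
  countTrue-pair (λ t → p (suc t)) a b (λ e → a≢b (cong suc e))
    (λ t t≢a t≢b → outside (suc t) (λ e → t≢a (suc-injective e)) (λ e → t≢b (suc-injective e)))

covers-sym : ∀ {V : Set} (B : Biclique V) u v → covers B u v ≡ covers B v u
covers-sym B u v = ∨-comm (X B u ∧ Y B v) (X B v ∧ Y B u)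

index : ∀ {k} → Fin k ⊎ Fin k → Fin k
index = [ id , id ]′

index≡⇔ : ∀ {k} {t : Fin k} {u} → index u ≡ t ⇔ (u ≡ inj₁ t ⊎ u ≡ inj₂ t)
index≡⇔ = mk⇔ to from
  where
  to : ∀ {k} {t : Fin k} {u} → index u ≡ t → u ≡ inj₁ t ⊎ u ≡ inj₂ t
  to {u = inj₁ _} refl = inj₁ refl
  to {u = inj₂ _} refl = inj₂ refl
  from : ∀ {k} {t : Fin k} {u} → u ≡ inj₁ t ⊎ u ≡ inj₂ t → index u ≡ t
  from (inj₁ refl) = refl
  from (inj₂ refl) = refl

module OrientedCover {k : ℕ} (H : Graph (Fin k)) where

  twins : Fin k → Subset (Fin k ⊎ Fin k)
  twins t u = does (index u ≟ t)

  orientedNbhd : Fin k → Subset (Fin k ⊎ Fin k)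
  orientedNbhd t (inj₁ b) = adj H t b ∧ does (t <? b)
  orientedNbhd t (inj₂ b) = adj H t b ∧ does (b <? t)

  orientedNbhd-twin : ∀ t u → index u ≡ t → orientedNbhd t u ≡ false
  orientedNbhd-twin t (inj₁ _) refl rewrite irrefl H t = refl
  orientedNbhd-twin t (inj₂ _) refl rewrite irrefl H t = refl

  twins-disjoint : ∀ t u → ¬ (twins t u ≡ true × orientedNbhd t u ≡ true)
  twins-disjoint t u (twin , inNbhd)
    with () ← trans (≡.sym (orientedNbhd-twin t u (Equivalence.to (does-true⇔ (index u ≟ t)) twin))) inNbhd

  B : Fin k → Biclique (Fin k ⊎ Fin k)
  B t = biclique (twins t) (orientedNbhd t) (twins-disjoint t)

  coverCount : Fin k ⊎ Fin k → Fin k ⊎ Fin k → ℕ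
  coverCount u v = countTrue (λ t → covers (B t) u v)

  covers-away : ∀ t u v → index u ≢ t → index v ≢ t → covers (B t) u v ≡ false
  covers-away t u v u≉t v≉t
    rewrite dec-false (index u ≟ t) u≉t | dec-false (index v ≟ t) v≉t = refl

  covers-from-twin : ∀ t u v → index u ≡ t → index v ≢ t → covers (B t) u v ≡ orientedNbhd t v
  covers-from-twin t u v u≈t v≉t
    rewrite dec-true (index u ≟ t) u≈t | dec-false (index v ≟ t) v≉t = ∨-identityʳ _

  covers-twins : ∀ t u v → index u ≡ t → index v ≡ t → covers (B t) u v ≡ false
  covers-twins t u v u≈t v≈t
    rewrite dec-true (index u ≟ t) u≈t | dec-true (index v ≟ t) v≈t
          | orientedNbhd-twin t u u≈t | orientedNbhd-twin t v v≈t = refl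

  coverCount-twins : ∀ u v → index u ≡ index v → coverCount u v ≡ 0
  coverCount-twins u v u≈v =
    trans (countTrue-single _ (index u)
             (λ t t≢u → covers-away t u v (≢-sym t≢u) (λ v≈t → t≢u (≡.sym (trans u≈v v≈t)))))
          (cong indicator (covers-twins (index u) u v refl (≡.sym u≈v)))

  coverCount-apart : ∀ u v → index u ≢ index v →
    coverCount u v ≡ indicator (orientedNbhd (index u) v) + indicator (orientedNbhd (index v) u)
  coverCount-apart u v u≉v =
    trans (countTrue-pair _ (index u) (index v) u≉v
             (λ t t≢u t≢v → covers-away t u v (≢-sym t≢u) (≢-sym t≢v)))
          (cong₂ (λ x y → indicator x + indicator y)
                 (covers-from-twin (index u) u v refl (≢-sym u≉v))
                 (trans (covers-sym (B (index v)) u v) (covers-from-twin (index v) v u refl u≉v)))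

  coverCount-%2 : ∀ u v → u ≢ v → coverCount u v % 2 ≡ indicator (adj (disjointUnion H H) u v)
  coverCount-%2 (inj₁ a) (inj₁ b) u≢v
    rewrite coverCount-apart (inj₁ a) (inj₁ b) (u≢v ∘ cong inj₁) | sym H b a =
      trans (cong (_% 2) (indicator-split-< (adj H a b) (u≢v ∘ cong inj₁))) (indicator-%2 _)
  coverCount-%2 (inj₂ a) (inj₂ b) u≢v
    rewrite coverCount-apart (inj₂ a) (inj₂ b) (u≢v ∘ cong inj₂) | sym H b a =
      trans (cong (_% 2) (indicator-split-< (adj H a b) (u≢v ∘ cong inj₂ ∘ ≡.sym))) (indicator-%2 _)
  coverCount-%2 (inj₁ a) (inj₂ b) _ with a ≟ b
  ... | yes refl rewrite coverCount-twins (inj₁ a) (inj₂ a) refl = refl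
  ... | no a≢b rewrite coverCount-apart (inj₁ a) (inj₂ b) a≢b | sym H b a =
    indicator-double-%2 (adj H a b ∧ does (b <? a))
  coverCount-%2 (inj₂ a) (inj₁ b) _ with a ≟ b
  ... | yes refl rewrite coverCount-twins (inj₂ a) (inj₁ a) refl = refl
  ... | no a≢b rewrite coverCount-apart (inj₂ a) (inj₁ b) a≢b | sym H b a =
    indicator-double-%2 (adj H a b ∧ does (a <? b))

  isOddCover : IsOddCover (disjointUnion H H) B
  isOddCover u v u≢v =
    parity⇒IsOddCover-clause (adj (disjointUnion H H) u v) (coverCount u v) (coverCount-%2 u v u≢v)

IsOddCover-cong : ∀ {V : Set} {n} {G G′ : Graph V} {B : Fin n → Biclique V} →
  (∀ u v → adj G u v ≡ adj G′ u v) → IsOddCover G B → IsOddCover G′ B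
IsOddCover-cong same cover u v u≢v rewrite ≡.sym (same u v) = cover u v u≢v

disjointUnion-congʳ : ∀ {A C : Set} (G : Graph A) {H H′ : Graph C} → (∀ i j → adj H i j ≡ adj H′ i j) →
  ∀ u v → adj (disjointUnion G H) u v ≡ adj (disjointUnion G H′) u v
disjointUnion-congʳ G same (inj₁ _) (inj₁ _) = refl
disjointUnion-congʳ G same (inj₁ _) (inj₂ _) = refl
disjointUnion-congʳ G same (inj₂ _) (inj₁ _) = refl
disjointUnion-congʳ G same (inj₂ i) (inj₂ j) = same i j

theorem7 : (k : ℕ) (H₁ H₂ : Graph (Fin k)) →
    (∀ i j → adj H₁ i j ≡ adj H₂ i j) →
    Σ (Fin k → Biclique (Fin k ⊎ Fin k)) (λ B →
      IsOddCover (disjointUnion H₁ H₂) B ×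
      (∀ i u → (X (B i) u ≡ true) ⇔ (u ≡ inj₁ i ⊎ u ≡ inj₂ i)))
theorem7 _ H₁ H₂ H₁≅H₂ =
    B
  , IsOddCover-cong {G = disjointUnion H₁ H₁} {G′ = disjointUnion H₁ H₂} {B = B}
                    (disjointUnion-congʳ H₁ H₁≅H₂) isOddCover
  , λ i u → index≡⇔ ⇔-∘ does-true⇔ (index u ≟ i)
  where open OrientedCover H₁
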